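{- For positive integers $k,\ell$ with $\ell\ge2$, \[ \theta(k,\ell)=\begin{cases}\frac{\lambda_2(k,\ell)}{k}&\text{for }(k,\ell)\in\{(1,2),(1,3),(1,4),(2,5),(2,6),(2,7),(2,8),(2,9)\},\\ \theta_B(k,\ell)&\text{for }k=1,\ \ell\ge5,\\ \min\big(\frac{\lambda_1(\ell)}{k},\frac{k}{\ell(k-1)}\big)&\text{otherwise}.\end{cases} \]
   Context: $\theta(k,\ell)=\max(\theta_A(k,\ell),\theta_B(k,\ell))$, where $\theta_A(k,\ell)=\min\big(\frac{\lambda_1(\ell)}{k},\frac{\lambda_2(k,\ell)}{k},\frac{k}{\ell(k-1)}\big)$ and $\theta_B(k,\ell)=\min\big(\frac{5}{12k},\frac{k}{\ell(k-1)}\big)$; convention: for $k=1$, $\frac{k}{\ell(k-1)}=+\infty$ and $\min(A,\infty)=A$. Here $\lambda_1(\ell)=\frac{\ell}{2(\ell-1)}$ for $2\le\ell\le3$, $\frac{3\ell^2+2\sqrt3\ell^{3/2}+\ell}{(3\ell-1)^2}$ for $3\le\ell\le\frac{25}{3}$, $\frac{5\ell}{4(3\ell-5)}$ for $\ell\ge\frac{25}{3}$; $\lambda_2(k,\ell)=\frac23(\frac k\ell+\frac12)$ for $\frac58\ell\le k$, $\frac{10}{49}+\frac{2k}{7\ell}+\frac47\sqrt{\frac67(\frac k\ell-\frac17)}$ for $\frac{31}{96}\ell\le k\le\frac58\ell$, $\frac{10}{11}(\frac k\ell+\frac14)$ for $k\le\frac{31}{96}\ell$. -}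

module Defs where

open import Data.Nat as ℕ using (ℕ; zero; suc; _≤?_)
open import Data.Integer using (+_)
open import Data.Rational using (ℚ; _/_; _<_; _≤_; _+_; _*_; _-_)
open import Data.Product using (_×_; _,_)
open import Data.Sum using (_⊎_)
open import Data.Unit using (⊤)
open import Data.List using (List; []; _∷_)
open import Data.List.Membership.Propositional using (_∈_)
open import Relation.Nullary using (yes; no)

-- Real numbers are not available in agda-stdlib.  A real number x is
-- represented by its strict lower Dedekind cut  { q ∈ ℚ | q < x }.
Cut : Set₁
Cut = ℚ → Set

infix 4 _≈_
_≈_ : Cut → Cut → Set
x ≈ y = ∀ q → (x q → y q) × (y q → x q)

ℕ→ℚ : ℕ → ℚ
ℕ→ℚ n = (+ n) / 1

nat : ℕ → Cut
nat a q = q < ℕ→ℚ a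

-- the real number a + b·√c  (a b c : ℕ)
-- q < a + b√c  iff  q < a  or  (a ≤ q and (q-a)² < b²c)
surd : ℕ → ℕ → ℕ → Cut
surd a b c q = (q < ℕ→ℚ a) ⊎
  ((ℕ→ℚ a ≤ q) × ((q - ℕ→ℚ a) * (q - ℕ→ℚ a) < ℕ→ℚ b * ℕ→ℚ b * ℕ→ℚ c))

-- division of a real by a positive natural d:  q < x/d  iff  q·d < x
-- (only ever used with d > 0)
infixl 7 _⊘_
_⊘_ : Cut → ℕ → Cut
(x ⊘ d) q = x (q * ℕ→ℚ d)

∞ : Cut
∞ _ = ⊤

min max : Cut → Cut → Cut
min x y q = x q × y q
max x y q = x q ⊎ y q

-- λ₁(ℓ) for integer ℓ ≥ 2:
--   ℓ/(2(ℓ-1))                                 for 2 ≤ ℓ ≤ 3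
--   (3ℓ²+ℓ + 2·√(3ℓ³)) / (3ℓ-1)²              for 3 ≤ ℓ ≤ 25/3  (i.e. ℓ ≤ 8)
--      (note 2√3·ℓ^{3/2} = 2√(3ℓ³))
--   5ℓ/(4(3ℓ-5))                               for ℓ ≥ 25/3      (i.e. ℓ ≥ 9)
λ₁ : ℕ → Cut
λ₁ ℓ with ℓ ≤? 3
... | yes _ = nat ℓ ⊘ (2 ℕ.* (ℓ ℕ.∸ 1))
... | no _ with ℓ ≤? 8
...   | yes _ = surd (3 ℕ.* ℓ ℕ.* ℓ ℕ.+ ℓ) 2 (3 ℕ.* ℓ ℕ.* ℓ ℕ.* ℓ)
                  ⊘ ((3 ℕ.* ℓ ℕ.∸ 1) ℕ.* (3 ℕ.* ℓ ℕ.∸ 1))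
...   | no _ = nat (5 ℕ.* ℓ) ⊘ (4 ℕ.* (3 ℕ.* ℓ ℕ.∸ 5))

-- λ₂(k,ℓ), with denominators cleared:
--   (2/3)(k/ℓ + 1/2)           = (2k+ℓ)/(3ℓ)                        for 5ℓ/8 ≤ k
--   10/49 + 2k/(7ℓ) + (4/7)√((6/7)(k/ℓ - 1/7))
--                              = (10ℓ + 14k + 4√(6ℓ(7k-ℓ)))/(49ℓ)  for 31ℓ/96 ≤ k ≤ 5ℓ/8
--   (10/11)(k/ℓ + 1/4)         = (40k+10ℓ)/(44ℓ)                    for k ≤ 31ℓ/96
λ₂ : ℕ → ℕ → Cut
λ₂ k ℓ with 5 ℕ.* ℓ ≤? 8 ℕ.* k
... | yes _ = nat (2 ℕ.* k ℕ.+ ℓ) ⊘ (3 ℕ.* ℓ)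
... | no _ with 31 ℕ.* ℓ ≤? 96 ℕ.* k
...   | yes _ = surd (10 ℕ.* ℓ ℕ.+ 14 ℕ.* k) 4 (6 ℕ.* ℓ ℕ.* (7 ℕ.* k ℕ.∸ ℓ))
                  ⊘ (49 ℕ.* ℓ)
...   | no _ = nat (40 ℕ.* k ℕ.+ 10 ℕ.* ℓ) ⊘ (44 ℕ.* ℓ)

-- k/(ℓ(k-1)), with the convention that it is +∞ for k = 1
κ : ℕ → ℕ → Cut
κ (suc zero) ℓ = ∞
κ k ℓ = nat k ⊘ (ℓ ℕ.* (k ℕ.∸ 1))

θA : ℕ → ℕ → Cut
θA k ℓ = min (λ₁ ℓ ⊘ k) (min (λ₂ k ℓ ⊘ k) (κ k ℓ))

θB : ℕ → ℕ → Cut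
θB k ℓ = min (nat 5 ⊘ (12 ℕ.* k)) (κ k ℓ)

θ : ℕ → ℕ → Cut
θ k ℓ = max (θA k ℓ) (θB k ℓ)

exceptionalPairs : List (ℕ × ℕ)
exceptionalPairs = (1 , 2) ∷ (1 , 3) ∷ (1 , 4) ∷ (2 , 5) ∷ (2 , 6) ∷ (2 , 7)
  ∷ (2 , 8) ∷ (2 , 9) ∷ []

Exceptional : ℕ → ℕ → Set
Exceptional k ℓ = (k , ℓ) ∈ exceptionalPairs

module Submission where

-- With a = λ₁(ℓ)/k, b = λ₂(k,ℓ)/k, K = k/(ℓ(k-1)) and f = 5/(12k) we have
-- θ = max(min(a, min(b, K)), min(f, K)), and lattice algebra on lower cuts
-- (module Collapse) turns each of the three claims into comparisons:
--   * exceptional pairs:   b ≤ a, b ≤ K and f ≤ b         give θ = b;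
--   * k = 1, ℓ ≥ 5:        b ≤ f                           gives θ = θ_B;
--   * all other pairs:     f ≤ a and min(a, K) ≤ b         give θ = min(a, K).
-- All reals involved are of the form A/D or (a + b√c)/d with natural
-- numbers, and comparing them reduces to inequalities between naturals
-- (module CutComparison).  λ₂ is then described on each of its three regimes
-- (top 5ℓ ≤ 8k, middle, bottom 96k < 31ℓ), which yields lower bounds for λ₂,
-- the bounds 5/12 ≤ λ₁ and λ₁ ≤ 45/88 (ℓ ≥ 9), and K ≤ b deep in the bottom
-- regime.  What is left is a finite set of pairs with ℓ ≤ 9, settled by
-- closed numerical comparisons that are decided by evaluation.

open import Defs
import Relation.Binary.Reasoning.Base.Single as SingleReasoning

infix 4 _⊑_
_⊑_ : Cut → Cut → Set
x ⊑ y = ∀ q → x q → y q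

⊑-refl : ∀ {x} → x ⊑ x
⊑-refl q h = h

⊑-trans : ∀ {x y z} → x ⊑ y → y ⊑ z → x ⊑ z
⊑-trans x⊑y y⊑z q h = y⊑z q (x⊑y q h)

module ⊑-Reasoning where
  private module Base = SingleReasoning _⊑_ ⊑-refl ⊑-trans
  open Base public using (begin_; _∎)

  infixr 2 step-⊑
  step-⊑ : ∀ x {y z} → y Base.IsRelatedTo z → x ⊑ y → x Base.IsRelatedTo z
  step-⊑ = Base.step-∼
  syntax step-⊑ x y⊑z x⊑y = x ⊑⟨ x⊑y ⟩ y⊑z

module CutComparison where

  open import Data.Nat as ℕ using (ℕ)
  import Data.Nat.Properties as ℕP
  open import Data.Nat.Coprimality using (1-coprimeTo) renaming (sym to coprime-sym)
  open import Data.Integer as ℤ using (+_)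
  import Data.Integer.Properties as ℤP
  open import Data.Rational as ℚ using (ℚ; mkℚ; _/_; _<_; _≤_; _+_; _*_; _-_; -_; 0ℚ)
  import Data.Rational.Properties as ℚP
  open import Data.Rational.Solver using (module +-*-Solver)
  open +-*-Solver
  open import Data.Empty using (⊥-elim)
  open import Data.Sum using (inj₁; inj₂)
  open import Data.Product using (_,_)
  open import Relation.Nullary using (yes; no)
  open import Relation.Binary.PropositionalEquality

  ι : ℕ → ℚ
  ι n = ℕ→ℚ n

  ι-normal : ∀ n → ι n ≡ mkℚ (+ n) 0 (coprime-sym (1-coprimeTo n))
  ι-normal n = ℚP.normalize-coprime (coprime-sym (1-coprimeTo n))

  ι-+ : ∀ m n → ι (m ℕ.+ n) ≡ ι m + ι n
  ι-+ m n rewrite ι-normal m | ι-normal n =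
    cong₂ (λ x y → (x ℤ.+ y) / 1) (sym (ℤP.*-identityʳ (+ m))) (sym (ℤP.*-identityʳ (+ n)))

  ι-* : ∀ m n → ι (m ℕ.* n) ≡ ι m * ι n
  ι-* m n rewrite ι-normal m | ι-normal n = cong (λ x → x / 1) (sym (ℤP.+◃n≡+n (m ℕ.* n)))

  ι-mono-≤ : ∀ {m n} → m ℕ.≤ n → ι m ≤ ι n
  ι-mono-≤ {m} {n} h rewrite ι-normal m | ι-normal n =
    ℚ.*≤* (subst₂ ℤ._≤_ (sym (ℤP.*-identityʳ (+ m))) (sym (ℤP.*-identityʳ (+ n))) (ℤ.+≤+ h))

  ι-mono-< : ∀ {m n} → m ℕ.< n → ι m < ι n
  ι-mono-< {m} {n} h rewrite ι-normal m | ι-normal n =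
    ℚ.*<* (subst₂ ℤ._<_ (sym (ℤP.*-identityʳ (+ m))) (sym (ℤP.*-identityʳ (+ n))) (ℤ.+<+ h))

  ι-∸ : ∀ m n → n ℕ.≤ m → ι (m ℕ.∸ n) ≡ ι m - ι n
  ι-∸ m n n≤m = begin
      ι (m ℕ.∸ n)                 ≡⟨ solve 2 (λ x y → x := x :+ y :- y) refl (ι (m ℕ.∸ n)) (ι n) ⟩
      ι (m ℕ.∸ n) + ι n - ι n     ≡⟨ cong (_- ι n) (sym (ι-+ (m ℕ.∸ n) n)) ⟩
      ι (m ℕ.∸ n ℕ.+ n) - ι n     ≡⟨ cong (λ z → ι z - ι n) (ℕP.m∸n+n≡m n≤m) ⟩
      ι m - ι n                   ∎
    where open ≡-Reasoning

  0≤ι : ∀ n → 0ℚ ≤ ι n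
  0≤ι n = ι-mono-≤ {0} {n} ℕ.z≤n

  ι-nonNeg : ∀ n → ℚ.NonNegative (ι n)
  ι-nonNeg n = ℚ.nonNegative (0≤ι n)

  ι-pos : ∀ {n} → 0 ℕ.< n → ℚ.Positive (ι n)
  ι-pos h = ℚ.positive (ι-mono-< h)

  *ι-mono-< : ∀ {x y} n → 0 ℕ.< n → x < y → x * ι n < y * ι n
  *ι-mono-< n n>0 = ℚP.*-monoˡ-<-pos (ι n) {{ι-pos n>0}}

  *ι-cancel-< : ∀ {x y} n → x * ι n < y * ι n → x < y
  *ι-cancel-< n = ℚP.*-cancelʳ-<-nonNeg (ι n) {{ι-nonNeg n}}

  square-mono-< : ∀ {u v} → 0ℚ ≤ u → u < v → u * u < v * v
  square-mono-< {u} {v} 0≤u u<v =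
    ℚP.≤-<-trans (ℚP.*-monoˡ-≤-nonNeg u {{ℚ.nonNegative 0≤u}} (ℚP.<⇒≤ u<v))
                 (ℚP.*-monoˡ-<-pos v {{ℚ.positive (ℚP.≤-<-trans 0≤u u<v)}} u<v)

  square-cancel-< : ∀ {u v} → 0ℚ ≤ v → u * u < v * v → u < v
  square-cancel-< {u} {v} 0≤v uu<vv with u ℚP.<? v
  ... | yes u<v = u<v
  ... | no u≮v = ⊥-elim (ℚP.<-irrefl refl (ℚP.<-≤-trans uu<vv vv≤uu))
    where
    v≤u : v ≤ u
    v≤u = ℚP.≮⇒≥ u≮v
    vv≤uu : v * v ≤ u * u
    vv≤uu = ℚP.≤-trans (ℚP.*-monoˡ-≤-nonNeg v {{ℚ.nonNegative 0≤v}} v≤u)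
                       (ℚP.*-monoʳ-≤-nonNeg u {{ℚ.nonNegative (ℚP.≤-trans 0≤v v≤u)}} v≤u)

  0≤difference : ∀ {x y} → x ≤ y → 0ℚ ≤ y - x
  0≤difference {x} {y} x≤y = subst (_≤ y - x) (ℚP.+-inverseʳ x) (ℚP.+-monoˡ-≤ (- x) x≤y)

  swap-factors : ∀ q d D → q * ι d * ι D ≡ q * ι D * ι d
  swap-factors q d D = solve 3 (λ x y z → x :* y :* z := x :* z :* y) refl q (ι d) (ι D)

  ι-b²c·D² : ∀ b c D → ι (b ℕ.* b ℕ.* c ℕ.* (D ℕ.* D)) ≡ ι b * ι b * ι c * (ι D * ι D)
  ι-b²c·D² b c D = trans (ι-* (b ℕ.* b ℕ.* c) (D ℕ.* D))
    (cong₂ _*_ (trans (ι-* (b ℕ.* b) c) (cong (_* ι c) (ι-* b b))) (ι-* D D))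

  square-scaled : ∀ x D → (x * D) * (x * D) ≡ (x * x) * (D * D)
  square-scaled = solve 2 (λ x y → (x :* y) :* (x :* y) := (x :* x) :* (y :* y)) refl

  ratio-≤ : ∀ A D A' D' → 0 ℕ.< D → 0 ℕ.< D' → A ℕ.* D' ℕ.≤ A' ℕ.* D → nat A ⊘ D ⊑ nat A' ⊘ D'
  ratio-≤ A D A' D' D>0 D'>0 cleared q q<A/D = *ι-cancel-< D (begin-strict
      q * ι D' * ι D   ≡⟨ swap-factors q D' D ⟩
      q * ι D * ι D'   <⟨ *ι-mono-< D' D'>0 q<A/D ⟩
      ι A * ι D'       ≡⟨ sym (ι-* A D') ⟩
      ι (A ℕ.* D')     ≤⟨ ι-mono-≤ cleared ⟩
      ι (A' ℕ.* D)     ≡⟨ ι-* A' D ⟩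
      ι A' * ι D       ∎)
    where open ℚP.≤-Reasoning

  surd-≤-ratio : ∀ a b c d A D → 0 ℕ.< d → 0 ℕ.< D → a ℕ.* D ℕ.≤ A ℕ.* d →
                 b ℕ.* b ℕ.* c ℕ.* (D ℕ.* D) ℕ.≤ (A ℕ.* d ℕ.∸ a ℕ.* D) ℕ.* (A ℕ.* d ℕ.∸ a ℕ.* D) →
                 surd a b c ⊘ d ⊑ nat A ⊘ D
  surd-≤-ratio a b c d A D d>0 D>0 aD≤Ad margin q s =
    *ι-cancel-< d (subst₂ _<_ (swap-factors q d D) (ι-* A d) (bound s))
    where
    open ℚP.≤-Reasoning
    p : ℚ
    p = q * ι d
    bound : surd a b c p → p * ι D < ι (A ℕ.* d)
    bound (inj₁ p<a) = begin-strict
      p * ι D       <⟨ *ι-mono-< D D>0 p<a ⟩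
      ι a * ι D     ≡⟨ sym (ι-* a D) ⟩
      ι (a ℕ.* D)   ≤⟨ ι-mono-≤ aD≤Ad ⟩
      ι (A ℕ.* d)   ∎
    bound (inj₂ (_ , square<)) = subst₂ _<_ u+aD≡pD v+aD≡Ad (ℚP.+-monoˡ-< (ι (a ℕ.* D)) u<v)
      where
      w : ℕ
      w = A ℕ.* d ℕ.∸ a ℕ.* D
      u v : ℚ
      u = (p - ι a) * ι D
      v = ι w
      u<v : u < v
      u<v = square-cancel-< (0≤ι w) (begin-strict
        u * u                                 ≡⟨ square-scaled (p - ι a) (ι D) ⟩
        (p - ι a) * (p - ι a) * (ι D * ι D)   <⟨ ℚP.*-monoˡ-<-pos (ι D * ι D)
                                                   {{subst ℚ.Positive (ι-* D D) (ι-pos (ℕP.*-mono-< D>0 D>0))}}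
                                                   square< ⟩
        ι b * ι b * ι c * (ι D * ι D)         ≡⟨ sym (ι-b²c·D² b c D) ⟩
        ι (b ℕ.* b ℕ.* c ℕ.* (D ℕ.* D))       ≤⟨ ι-mono-≤ margin ⟩
        ι (w ℕ.* w)                           ≡⟨ ι-* w w ⟩
        v * v                                 ∎)
      u+aD≡pD : u + ι (a ℕ.* D) ≡ p * ι D
      u+aD≡pD = trans (cong (λ z → u + z) (ι-* a D))
        (solve 3 (λ x y z → (x :- y) :* z :+ y :* z := x :* z) refl p (ι a) (ι D))
      v+aD≡Ad : v + ι (a ℕ.* D) ≡ ι (A ℕ.* d)
      v+aD≡Ad = trans (cong (_+ ι (a ℕ.* D)) (ι-∸ _ _ aD≤Ad))
        (solve 2 (λ x y → x :- y :+ y := x) refl (ι (A ℕ.* d)) (ι (a ℕ.* D)))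

  ratio-≤-surd : ∀ A D a b c d → 0 ℕ.< D → 0 ℕ.< d →
                 (A ℕ.* d ℕ.∸ a ℕ.* D) ℕ.* (A ℕ.* d ℕ.∸ a ℕ.* D) ℕ.≤ b ℕ.* b ℕ.* c ℕ.* (D ℕ.* D) →
                 nat A ⊘ D ⊑ surd a b c ⊘ d
  ratio-≤-surd A D a b c d D>0 d>0 margin q q<A/D with q * ι d ℚP.<? ι a
  ... | yes p<a = inj₁ p<a
  ... | no p≮a = inj₂ (a≤p , square<)
    where
    open ℚP.≤-Reasoning
    p : ℚ
    p = q * ι d
    a≤p : ι a ≤ p
    a≤p = ℚP.≮⇒≥ p≮a
    pD<Ad : p * ι D < ι (A ℕ.* d)
    pD<Ad = subst₂ _<_ (sym (swap-factors q d D)) (sym (ι-* A d)) (*ι-mono-< d d>0 q<A/D)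
    aD≤pD : ι (a ℕ.* D) ≤ p * ι D
    aD≤pD = subst (_≤ p * ι D) (sym (ι-* a D)) (ℚP.*-monoʳ-≤-nonNeg (ι D) {{ι-nonNeg D}} a≤p)
    aD≤Ad : a ℕ.* D ℕ.≤ A ℕ.* d
    aD≤Ad with a ℕ.* D ℕP.≤? A ℕ.* d
    ... | yes h = h
    ... | no h = ⊥-elim (ℚP.<-irrefl refl
                   (ℚP.<-trans (ι-mono-< (ℕP.≰⇒> h)) (ℚP.≤-<-trans aD≤pD pD<Ad)))
    w : ℕ
    w = A ℕ.* d ℕ.∸ a ℕ.* D
    u v : ℚ
    u = (p - ι a) * ι D
    v = ι w
    0≤u : 0ℚ ≤ u
    0≤u = subst (_≤ u) (ℚP.*-zeroˡ (ι D)) (ℚP.*-monoʳ-≤-nonNeg (ι D) {{ι-nonNeg D}} (0≤difference a≤p))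
    u≡pD-aD : u ≡ p * ι D - ι (a ℕ.* D)
    u≡pD-aD = trans (solve 3 (λ x y z → (x :- y) :* z := x :* z :- y :* z) refl p (ι a) (ι D))
                    (cong (λ z → p * ι D - z) (sym (ι-* a D)))
    u<v : u < v
    u<v = subst₂ _<_ (sym u≡pD-aD) (sym (ι-∸ _ _ aD≤Ad)) (ℚP.+-monoˡ-< (- ι (a ℕ.* D)) pD<Ad)
    DD : ℚ
    DD = ι D * ι D
    square< : (p - ι a) * (p - ι a) < ι b * ι b * ι c
    square< = ℚP.*-cancelʳ-<-nonNeg DD {{subst ℚ.NonNegative (ι-* D D) (ι-nonNeg (D ℕ.* D))}}
      (begin-strict
        (p - ι a) * (p - ι a) * DD        ≡⟨ sym (square-scaled (p - ι a) (ι D)) ⟩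
        u * u                             <⟨ square-mono-< 0≤u u<v ⟩
        v * v                             ≡⟨ sym (ι-* w w) ⟩
        ι (w ℕ.* w)                       ≤⟨ ι-mono-≤ margin ⟩
        ι (b ℕ.* b ℕ.* c ℕ.* (D ℕ.* D))   ≡⟨ ι-b²c·D² b c D ⟩
        ι b * ι b * ι c * DD              ∎)

  ⊘-mono : ∀ {x y} k → x ⊑ y → x ⊘ k ⊑ y ⊘ k
  ⊘-mono k x⊑y q = x⊑y (q * ι k)

  -- (x/D)/k = x/(D·k), at the level of the cut argument
  ⊘-⊘ : ∀ q D k → q * ι k * ι D ≡ q * ι (D ℕ.* k)
  ⊘-⊘ q D k = trans (ℚP.*-assoc q (ι k) (ι D))
                    (cong (q *_) (trans (ℚP.*-comm (ι k) (ι D)) (sym (ι-* D k))))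

  divide-upper : ∀ {x} y D k → x ⊑ y ⊘ D → x ⊘ k ⊑ y ⊘ (D ℕ.* k)
  divide-upper y D k x⊑y/D q h = subst y (⊘-⊘ q D k) (x⊑y/D (q * ι k) h)

  divide-lower : ∀ {x} y D k → y ⊘ D ⊑ x → y ⊘ (D ℕ.* k) ⊑ x ⊘ k
  divide-lower y D k y/D⊑x q h = y/D⊑x (q * ι k) (subst y (sym (⊘-⊘ q D k)) h)

open CutComparison using (ratio-≤; surd-≤-ratio; ratio-≤-surd; ⊘-mono; divide-upper; divide-lower)

open import Data.Nat using (ℕ; suc; _+_; _*_; _∸_; _≤_; _<_; _≤?_; _≤ᵇ_; z≤n; s≤s)
import Data.Nat.Properties as ℕP
open import Data.Nat.Solver using (module +-*-Solver)
open +-*-Solver using (solve; _:+_; _:*_; _:=_; con)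
open import Data.Bool using (T)
open import Data.Empty using (⊥-elim)
open import Data.Unit using (tt)
open import Data.Sum using (inj₁; inj₂; [_,_]′)
open import Data.Product using (_×_; _,_; proj₁; proj₂)
open import Data.Product.Properties using (≡-dec)
open import Data.List.Relation.Unary.Any using (here; there)
open import Data.List.Membership.DecPropositional (≡-dec ℕP._≟_ ℕP._≟_) using (_∈?_)
open import Function using (id)
open import Relation.Nullary using (¬_; yes; no)
open import Relation.Nullary.Decidable using (True; toWitness)
open import Relation.Binary.PropositionalEquality using (_≡_; refl; sym; trans; cong; cong₂; subst)

≈⇒⊑ : ∀ {x y} → x ≈ y → x ⊑ y
≈⇒⊑ x≈y q = proj₁ (x≈y q)

≈⇒⊒ : ∀ {x y} → x ≈ y → y ⊑ x
≈⇒⊒ x≈y q = proj₂ (x≈y q)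

≈-sym : ∀ {x y} → x ≈ y → y ≈ x
≈-sym x≈y q = proj₂ (x≈y q) , proj₁ (x≈y q)

≈-trans : ∀ {x y z} → x ≈ y → y ≈ z → x ≈ z
≈-trans x≈y y≈z q = (λ h → proj₁ (y≈z q) (proj₁ (x≈y q) h))
                  , (λ h → proj₂ (x≈y q) (proj₂ (y≈z q) h))

min-⊑ˡ : ∀ {x y z} → x ⊑ z → min x y ⊑ z
min-⊑ˡ x⊑z q (xq , _) = x⊑z q xq

min-⊑ʳ : ∀ {x y z} → y ⊑ z → min x y ⊑ z
min-⊑ʳ y⊑z q (_ , yq) = y⊑z q yq

through : ∀ {x y} A D → x ⊑ nat A ⊘ D → nat A ⊘ D ⊑ y → x ⊑ y
through A D = ⊑-trans

computed : ∀ {m n} {_ : T (m ≤ᵇ n)} → m ≤ n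
computed {m} {n} {m≤ᵇn} = ℕP.≤ᵇ⇒≤ m n m≤ᵇn

≤-by-excess : ∀ {m n} r → m + r ≡ n → m ≤ n
≤-by-excess {m} r refl = ℕP.m≤m+n m r

*-positive : ∀ {m n} → 0 < m → 0 < n → 0 < m * n
*-positive = ℕP.*-mono-<

exceptional : ∀ {k ℓ} {_ : True ((k , ℓ) ∈? exceptionalPairs)} → Exceptional k ℓ
exceptional {_} {_} {member} = toWitness member

ratio≤ratio : ∀ A D A' D' {_ : T (1 ≤ᵇ D)} {_ : T (1 ≤ᵇ D')} {_ : T (A * D' ≤ᵇ A' * D)} →
              nat A ⊘ D ⊑ nat A' ⊘ D'
ratio≤ratio A D A' D' {D>0} {D'>0} {cleared} =
  ratio-≤ A D A' D' (ℕP.≤ᵇ⇒≤ _ _ D>0) (ℕP.≤ᵇ⇒≤ _ _ D'>0) (ℕP.≤ᵇ⇒≤ _ _ cleared)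

surd≤ratio : ∀ a b c d A D {_ : T (1 ≤ᵇ d)} {_ : T (1 ≤ᵇ D)} {_ : T (a * D ≤ᵇ A * d)}
             {_ : T (b * b * c * (D * D) ≤ᵇ (A * d ∸ a * D) * (A * d ∸ a * D))} →
             surd a b c ⊘ d ⊑ nat A ⊘ D
surd≤ratio a b c d A D {d>0} {D>0} {aD≤Ad} {margin} =
  surd-≤-ratio a b c d A D (ℕP.≤ᵇ⇒≤ _ _ d>0) (ℕP.≤ᵇ⇒≤ _ _ D>0)
               (ℕP.≤ᵇ⇒≤ _ _ aD≤Ad) (ℕP.≤ᵇ⇒≤ _ _ margin)

ratio≤surd : ∀ A D a b c d {_ : T (1 ≤ᵇ D)} {_ : T (1 ≤ᵇ d)}
             {_ : T ((A * d ∸ a * D) * (A * d ∸ a * D) ≤ᵇ b * b * c * (D * D))} →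
             nat A ⊘ D ⊑ surd a b c ⊘ d
ratio≤surd A D a b c d {D>0} {d>0} {margin} =
  ratio-≤-surd A D a b c d (ℕP.≤ᵇ⇒≤ _ _ D>0) (ℕP.≤ᵇ⇒≤ _ _ d>0) (ℕP.≤ᵇ⇒≤ _ _ margin)

surd-shift : ∀ a b c d e → 0 < d → e * e ≤ b * b * c → nat (a + e) ⊘ d ⊑ surd a b c ⊘ d
surd-shift a b c d e d>0 e²≤b²c = ratio-≤-surd (a + e) d a b c d d>0 d>0 (begin
    ((a + e) * d ∸ a * d) * ((a + e) * d ∸ a * d)  ≡⟨ cong₂ _*_ difference difference ⟩
    e * d * (e * d)                                ≡⟨ solve 2 (λ e d → e :* d :* (e :* d) := e :* e :* (d :* d)) refl e d ⟩
    e * e * (d * d)                                ≤⟨ ℕP.*-monoˡ-≤ (d * d) e²≤b²c ⟩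
    b * b * c * (d * d)                            ∎)
  where
  open ℕP.≤-Reasoning
  difference : (a + e) * d ∸ a * d ≡ e * d
  difference = trans (cong (_∸ a * d) (ℕP.*-distribʳ-+ d a e)) (ℕP.m+n∸m≡n (a * d) (e * d))

module Collapse (a b K f : Cut) where

  Θ : Cut
  Θ = max (min a (min b K)) (min f K)

  to-b : b ⊑ a → b ⊑ K → f ⊑ b → Θ ≈ b
  to-b b⊑a b⊑K f⊑b q =
      (λ { (inj₁ (_ , bq , _)) → bq ; (inj₂ (fq , _)) → f⊑b q fq })
    , (λ bq → inj₁ (b⊑a q bq , bq , b⊑K q bq))

  to-fK : b ⊑ f → Θ ≈ min f K
  to-fK b⊑f q = (λ { (inj₁ (_ , bq , Kq)) → b⊑f q bq , Kq ; (inj₂ fK) → fK }) , inj₂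

  to-aK : f ⊑ a → min a K ⊑ b → Θ ≈ min a K
  to-aK f⊑a aK⊑b q =
      (λ { (inj₁ (aq , _ , Kq)) → aq , Kq ; (inj₂ (fq , Kq)) → f⊑a q fq , Kq })
    , (λ { (aq , Kq) → inj₁ (aq , aK⊑b q (aq , Kq) , Kq) })

module θ-collapse (k ℓ : ℕ) = Collapse (λ₁ ℓ ⊘ k) (λ₂ k ℓ ⊘ k) (κ k ℓ) (nat 5 ⊘ (12 * k))

bottom⇒¬top : ∀ k ℓ → 96 * k < 31 * ℓ → ¬ (5 * ℓ ≤ 8 * k)
bottom⇒¬top k ℓ bottom top = ℕP.<⇒≱ bottom (begin
    31 * ℓ        ≤⟨ ℕP.*-monoˡ-≤ ℓ (computed {31} {60}) ⟩
    60 * ℓ        ≡⟨ solve 1 (λ ℓ → con 60 :* ℓ := con 12 :* (con 5 :* ℓ)) refl ℓ ⟩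
    12 * (5 * ℓ)  ≤⟨ ℕP.*-monoʳ-≤ 12 top ⟩
    12 * (8 * k)  ≡⟨ solve 1 (λ k → con 12 :* (con 8 :* k) := con 96 :* k) refl k ⟩
    96 * k        ∎)
  where open ℕP.≤-Reasoning

deep-bottom : ∀ k ℓ → 16 * k < 5 * ℓ → 96 * k < 31 * ℓ
deep-bottom k ℓ h = begin-strict
    96 * k        ≡⟨ solve 1 (λ k → con 96 :* k := con 6 :* (con 16 :* k)) refl k ⟩
    6 * (16 * k)  <⟨ ℕP.*-monoʳ-< 6 h ⟩
    6 * (5 * ℓ)   ≡⟨ solve 1 (λ ℓ → con 6 :* (con 5 :* ℓ) := con 30 :* ℓ) refl ℓ ⟩
    30 * ℓ        ≤⟨ ℕP.*-monoˡ-≤ ℓ (computed {30} {31}) ⟩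
    31 * ℓ        ∎
  where open ℕP.≤-Reasoning

-- In the middle regime 31ℓ ≤ 96k the surd term 4√(6ℓ(7k−ℓ)) of λ₂ is at least
-- 11ℓ: squared, 121ℓ² ≤ 96ℓ(7k−ℓ), i.e. 121ℓ + 96ℓ = 7·31ℓ ≤ 96·7k.
middle-surd-margin : ∀ k ℓ → 31 * ℓ ≤ 96 * k → 11 * ℓ * (11 * ℓ) ≤ 4 * 4 * (6 * ℓ * (7 * k ∸ ℓ))
middle-surd-margin k ℓ middle = begin
    11 * ℓ * (11 * ℓ)               ≡⟨ solve 1 (λ ℓ → con 11 :* ℓ :* (con 11 :* ℓ) := con 121 :* ℓ :* ℓ) refl ℓ ⟩
    121 * ℓ * ℓ                     ≤⟨ ℕP.*-monoˡ-≤ ℓ 121ℓ≤96w ⟩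
    96 * (7 * k ∸ ℓ) * ℓ            ≡⟨ regroup (7 * k ∸ ℓ) ℓ ⟩
    4 * 4 * (6 * ℓ * (7 * k ∸ ℓ))   ∎
  where
  open ℕP.≤-Reasoning
  regroup : ∀ w ℓ → 96 * w * ℓ ≡ 4 * 4 * (6 * ℓ * w)
  regroup w ℓ = solve 2 (λ w ℓ → con 96 :* w :* ℓ := con 4 :* con 4 :* (con 6 :* ℓ :* w)) refl w ℓ
  split : ∀ w ℓ → 96 * (w + ℓ) ≡ 96 * w + 96 * ℓ
  split w ℓ = solve 2 (λ w ℓ → con 96 :* (w :+ ℓ) := con 96 :* w :+ con 96 :* ℓ) refl w ℓ
  key : 121 * ℓ + 96 * ℓ ≤ 96 * (7 * k)
  key = begin
    121 * ℓ + 96 * ℓ   ≡⟨ solve 1 (λ ℓ → con 121 :* ℓ :+ con 96 :* ℓ := con 7 :* (con 31 :* ℓ)) refl ℓ ⟩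
    7 * (31 * ℓ)       ≤⟨ ℕP.*-monoʳ-≤ 7 middle ⟩
    7 * (96 * k)       ≡⟨ solve 1 (λ k → con 7 :* (con 96 :* k) := con 96 :* (con 7 :* k)) refl k ⟩
    96 * (7 * k)       ∎
  ℓ≤7k : ℓ ≤ 7 * k
  ℓ≤7k = ℕP.*-cancelˡ-≤ 96 (ℕP.≤-trans (ℕP.m≤n+m (96 * ℓ) (121 * ℓ)) key)
  121ℓ≤96w : 121 * ℓ ≤ 96 * (7 * k ∸ ℓ)
  121ℓ≤96w = ℕP.+-cancelʳ-≤ (96 * ℓ) (121 * ℓ) (96 * (7 * k ∸ ℓ)) (begin
    121 * ℓ + 96 * ℓ            ≤⟨ key ⟩
    96 * (7 * k)                ≡⟨ cong (96 *_) (sym (ℕP.m∸n+n≡m ℓ≤7k)) ⟩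
    96 * (7 * k ∸ ℓ + ℓ)        ≡⟨ split (7 * k ∸ ℓ) ℓ ⟩
    96 * (7 * k ∸ ℓ) + 96 * ℓ   ∎)

-- Unfolding λ₂ by case analysis on its tests
-- normalises the goal; the ratio compared with λ₂ is kept under the opaque
-- name `opaque-ratio` meanwhile, so that its rational arithmetic is not expanded.
opaque
  opaque-ratio : ℕ → ℕ → Cut
  opaque-ratio A D = nat A ⊘ D

  opaque-ratio-≈ : ∀ A D → nat A ⊘ D ≈ opaque-ratio A D
  opaque-ratio-≈ A D q = id , id

λ₂-top : ∀ k ℓ → 5 * ℓ ≤ 8 * k → nat (2 * k + ℓ) ⊘ (3 * ℓ) ⊑ λ₂ k ℓ
λ₂-top k ℓ top = ⊑-trans (≈⇒⊑ (opaque-ratio-≈ A (3 * ℓ))) unfold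
  where
  A : ℕ
  A = 2 * k + ℓ
  unfold : opaque-ratio A (3 * ℓ) ⊑ λ₂ k ℓ
  unfold with 5 * ℓ ≤? 8 * k
  ... | yes _ = ≈⇒⊒ (opaque-ratio-≈ A (3 * ℓ))
  ... | no ¬top = ⊥-elim (¬top top)

λ₂-middle : ∀ k ℓ → 0 < ℓ → 8 * k < 5 * ℓ → 31 * ℓ ≤ 96 * k →
            nat (10 * ℓ + 14 * k + 11 * ℓ) ⊘ (49 * ℓ) ⊑ λ₂ k ℓ
λ₂-middle k ℓ ℓ>0 ¬top middle = ⊑-trans (≈⇒⊑ (opaque-ratio-≈ A (49 * ℓ))) unfold
  where
  A : ℕ
  A = 10 * ℓ + 14 * k + 11 * ℓ
  unfold : opaque-ratio A (49 * ℓ) ⊑ λ₂ k ℓ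
  unfold with 5 * ℓ ≤? 8 * k
  ... | yes top = ⊥-elim (ℕP.<⇒≱ ¬top top)
  ... | no _ with 31 * ℓ ≤? 96 * k
  ...   | yes _ = ⊑-trans (≈⇒⊒ (opaque-ratio-≈ A (49 * ℓ)))
                    (surd-shift (10 * ℓ + 14 * k) 4 (6 * ℓ * (7 * k ∸ ℓ)) (49 * ℓ) (11 * ℓ)
                       (*-positive (computed {1} {49}) ℓ>0) (middle-surd-margin k ℓ middle))
  ...   | no ¬middle = ⊥-elim (¬middle middle)

λ₂-bottom : ∀ k ℓ → 96 * k < 31 * ℓ → λ₂ k ℓ ≈ nat (40 * k + 10 * ℓ) ⊘ (44 * ℓ)
λ₂-bottom k ℓ bottom = ≈-trans unfold (≈-sym (opaque-ratio-≈ A (44 * ℓ)))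
  where
  A : ℕ
  A = 40 * k + 10 * ℓ
  unfold : λ₂ k ℓ ≈ opaque-ratio A (44 * ℓ)
  unfold with 5 * ℓ ≤? 8 * k
  ... | yes top = ⊥-elim (bottom⇒¬top k ℓ bottom top)
  ... | no _ with 31 * ℓ ≤? 96 * k
  ...   | yes middle = ⊥-elim (ℕP.<⇒≱ bottom middle)
  ...   | no _ = opaque-ratio-≈ A (44 * ℓ)

-- The cleared forms of 3/4 ≤ (2k+ℓ)/(3ℓ) (top) and 25/48 ≤ (21ℓ+14k)/(49ℓ) (middle).
top-≥-3/4 : ∀ k ℓ → 5 * ℓ ≤ 8 * k → 3 * (3 * ℓ) ≤ (2 * k + ℓ) * 4
top-≥-3/4 k ℓ top = begin
    3 * (3 * ℓ)       ≡⟨ solve 1 (λ ℓ → con 3 :* (con 3 :* ℓ) := con 5 :* ℓ :+ con 4 :* ℓ) refl ℓ ⟩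
    5 * ℓ + 4 * ℓ     ≤⟨ ℕP.+-monoˡ-≤ (4 * ℓ) top ⟩
    8 * k + 4 * ℓ     ≡⟨ solve 2 (λ k ℓ → con 8 :* k :+ con 4 :* ℓ := (con 2 :* k :+ ℓ) :* con 4) refl k ℓ ⟩
    (2 * k + ℓ) * 4   ∎
  where open ℕP.≤-Reasoning

middle-≥-25/48 : ∀ k ℓ → 31 * ℓ ≤ 96 * k → 25 * (49 * ℓ) ≤ (10 * ℓ + 14 * k + 11 * ℓ) * 48
middle-≥-25/48 k ℓ middle = begin
    25 * (49 * ℓ)
      ≡⟨ solve 1 (λ ℓ → con 25 :* (con 49 :* ℓ) := con 1008 :* ℓ :+ con 7 :* (con 31 :* ℓ)) refl ℓ ⟩
    1008 * ℓ + 7 * (31 * ℓ)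
      ≤⟨ ℕP.+-monoʳ-≤ (1008 * ℓ) (ℕP.*-monoʳ-≤ 7 middle) ⟩
    1008 * ℓ + 7 * (96 * k)
      ≡⟨ solve 2 (λ k ℓ → con 1008 :* ℓ :+ con 7 :* (con 96 :* k)
                        := (con 10 :* ℓ :+ con 14 :* k :+ con 11 :* ℓ) :* con 48) refl k ℓ ⟩
    (10 * ℓ + 14 * k + 11 * ℓ) * 48
      ∎
  where open ℕP.≤-Reasoning

-- Outside the bottom regime λ₂ ≥ 25/48, its value on the boundary k/ℓ = 31/96.
λ₂-≥-25/48 : ∀ k ℓ → 0 < ℓ → 31 * ℓ ≤ 96 * k → nat 25 ⊘ 48 ⊑ λ₂ k ℓ
λ₂-≥-25/48 k ℓ ℓ>0 ¬bottom = [ via-top , via-middle ]′ (ℕP.≤-<-connex (5 * ℓ) (8 * k))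
  where
  open ⊑-Reasoning
  via-top : 5 * ℓ ≤ 8 * k → nat 25 ⊘ 48 ⊑ λ₂ k ℓ
  via-top top = begin
    nat 25 ⊘ 48                  ⊑⟨ ratio≤ratio 25 48 3 4 ⟩
    nat 3 ⊘ 4                    ⊑⟨ ratio-≤ 3 4 (2 * k + ℓ) (3 * ℓ) computed
                                      (*-positive (computed {1} {3}) ℓ>0) (top-≥-3/4 k ℓ top) ⟩
    nat (2 * k + ℓ) ⊘ (3 * ℓ)    ⊑⟨ λ₂-top k ℓ top ⟩
    λ₂ k ℓ                       ∎
  via-middle : 8 * k < 5 * ℓ → nat 25 ⊘ 48 ⊑ λ₂ k ℓ
  via-middle ¬top = begin
    nat 25 ⊘ 48
      ⊑⟨ ratio-≤ 25 48 (10 * ℓ + 14 * k + 11 * ℓ) (49 * ℓ) computed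
           (*-positive (computed {1} {49}) ℓ>0) (middle-≥-25/48 k ℓ ¬bottom) ⟩
    nat (10 * ℓ + 14 * k + 11 * ℓ) ⊘ (49 * ℓ)
      ⊑⟨ λ₂-middle k ℓ ℓ>0 ¬top ¬bottom ⟩
    λ₂ k ℓ
      ∎

λ₂-≥ : ∀ k ℓ A D → 0 < ℓ → 0 < D → A * 48 ≤ 25 * D → A * (44 * ℓ) ≤ (40 * k + 10 * ℓ) * D →
       nat A ⊘ D ⊑ λ₂ k ℓ
λ₂-≥ k ℓ A D ℓ>0 D>0 A/D≤25/48 below-bottom =
  [ via-bottom , via-25/48 ]′ (ℕP.<-≤-connex (96 * k) (31 * ℓ))
  where
  open ⊑-Reasoning
  via-bottom : 96 * k < 31 * ℓ → nat A ⊘ D ⊑ λ₂ k ℓ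
  via-bottom bottom = begin
    nat A ⊘ D                          ⊑⟨ ratio-≤ A D (40 * k + 10 * ℓ) (44 * ℓ) D>0
                                            (*-positive (computed {1} {44}) ℓ>0) below-bottom ⟩
    nat (40 * k + 10 * ℓ) ⊘ (44 * ℓ)   ⊑⟨ ≈⇒⊒ (λ₂-bottom k ℓ bottom) ⟩
    λ₂ k ℓ                             ∎
  via-25/48 : 31 * ℓ ≤ 96 * k → nat A ⊘ D ⊑ λ₂ k ℓ
  via-25/48 ¬bottom = begin
    nat A ⊘ D      ⊑⟨ ratio-≤ A D 25 48 D>0 computed A/D≤25/48 ⟩
    nat 25 ⊘ 48    ⊑⟨ λ₂-≥-25/48 k ℓ ℓ>0 ¬bottom ⟩
    λ₂ k ℓ         ∎

5/12⊑λ₂ : ∀ k ℓ → 0 < ℓ → 5 * ℓ ≤ 24 * k → nat 5 ⊘ 12 ⊑ λ₂ k ℓ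
5/12⊑λ₂ k ℓ ℓ>0 h = λ₂-≥ k ℓ 5 12 ℓ>0 computed computed (begin
    5 * (44 * ℓ)
      ≡⟨ solve 1 (λ ℓ → con 5 :* (con 44 :* ℓ) := con 20 :* (con 5 :* ℓ) :+ con 120 :* ℓ) refl ℓ ⟩
    20 * (5 * ℓ) + 120 * ℓ
      ≤⟨ ℕP.+-monoˡ-≤ (120 * ℓ) (ℕP.*-monoʳ-≤ 20 h) ⟩
    20 * (24 * k) + 120 * ℓ
      ≡⟨ solve 2 (λ k ℓ → con 20 :* (con 24 :* k) :+ con 120 :* ℓ
                        := (con 40 :* k :+ con 10 :* ℓ) :* con 12) refl k ℓ ⟩
    (40 * k + 10 * ℓ) * 12
      ∎)
  where open ℕP.≤-Reasoning

45/88⊑λ₂ : ∀ k ℓ → 0 < ℓ → 5 * ℓ ≤ 16 * k → nat 45 ⊘ 88 ⊑ λ₂ k ℓ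
45/88⊑λ₂ k ℓ ℓ>0 h = λ₂-≥ k ℓ 45 88 ℓ>0 computed computed (begin
    45 * (44 * ℓ)
      ≡⟨ solve 1 (λ ℓ → con 45 :* (con 44 :* ℓ) := con 220 :* (con 5 :* ℓ) :+ con 880 :* ℓ) refl ℓ ⟩
    220 * (5 * ℓ) + 880 * ℓ
      ≤⟨ ℕP.+-monoˡ-≤ (880 * ℓ) (ℕP.*-monoʳ-≤ 220 h) ⟩
    220 * (16 * k) + 880 * ℓ
      ≡⟨ solve 2 (λ k ℓ → con 220 :* (con 16 :* k) :+ con 880 :* ℓ
                        := (con 40 :* k :+ con 10 :* ℓ) :* con 88) refl k ℓ ⟩
    (40 * k + 10 * ℓ) * 88
      ∎)
  where open ℕP.≤-Reasoning

-- For ℓ = 9 + m, λ₁(ℓ) = 5ℓ/(4(3ℓ − 5)) and 3ℓ − 5 = 22 + 3m.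
λ₁-large-denominator : ∀ m → 3 * (9 + m) ∸ 5 ≡ 22 + 3 * m
λ₁-large-denominator m =
  trans (cong (_∸ 5) (solve 1 (λ m → con 3 :* (con 9 :+ m) := con 5 :+ (con 22 :+ con 3 :* m)) refl m))
        (ℕP.m+n∸m≡n 5 (22 + 3 * m))

λ₁-large-≤-45/88 : ∀ m → λ₁ (9 + m) ⊑ nat 45 ⊘ 88
λ₁-large-≤-45/88 m =
  subst (λ δ → nat (5 * (9 + m)) ⊘ (4 * δ) ⊑ nat 45 ⊘ 88) (sym (λ₁-large-denominator m))
        (ratio-≤ (5 * (9 + m)) (4 * (22 + 3 * m)) 45 88 (s≤s z≤n) computed
           (≤-by-excess (100 * m)
              (solve 1 (λ m → con 5 :* (con 9 :+ m) :* con 88 :+ con 100 :* m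
                            := con 45 :* (con 4 :* (con 22 :+ con 3 :* m))) refl m)))

λ₁-large-≥-5/12 : ∀ m → nat 5 ⊘ 12 ⊑ λ₁ (9 + m)
λ₁-large-≥-5/12 m =
  subst (λ δ → nat 5 ⊘ 12 ⊑ nat (5 * (9 + m)) ⊘ (4 * δ)) (sym (λ₁-large-denominator m))
        (ratio-≤ 5 12 (5 * (9 + m)) (4 * (22 + 3 * m)) computed (s≤s z≤n)
           (≤-by-excess 100
              (solve 1 (λ m → con 5 :* (con 4 :* (con 22 :+ con 3 :* m)) :+ con 100
                            := con 5 :* (con 9 :+ m) :* con 12) refl m)))

λ₁-≥-5/12 : ∀ ℓ → 2 ≤ ℓ → nat 5 ⊘ 12 ⊑ λ₁ ℓ
λ₁-≥-5/12 0 ()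
λ₁-≥-5/12 1 (s≤s ())
λ₁-≥-5/12 2 _ = ratio≤ratio 5 12 2 2
λ₁-≥-5/12 3 _ = ratio≤ratio 5 12 3 4
λ₁-≥-5/12 4 _ = ratio≤surd 5 12 52 2 192 121
λ₁-≥-5/12 5 _ = ratio≤surd 5 12 80 2 375 196
λ₁-≥-5/12 6 _ = ratio≤surd 5 12 114 2 648 289
λ₁-≥-5/12 7 _ = ratio≤surd 5 12 154 2 1029 400
λ₁-≥-5/12 8 _ = ratio≤surd 5 12 200 2 1536 529
λ₁-≥-5/12 (suc (suc (suc (suc (suc (suc (suc (suc (suc m))))))))) _ = λ₁-large-≥-5/12 m

λ₁-≤-3/4 : ∀ ℓ → 3 ≤ ℓ → λ₁ ℓ ⊑ nat 3 ⊘ 4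
λ₁-≤-3/4 0 ()
λ₁-≤-3/4 1 (s≤s ())
λ₁-≤-3/4 2 (s≤s (s≤s ()))
λ₁-≤-3/4 3 _ = ⊑-refl
λ₁-≤-3/4 4 _ = surd≤ratio 52 2 192 121 3 4
λ₁-≤-3/4 5 _ = surd≤ratio 80 2 375 196 3 4
λ₁-≤-3/4 6 _ = surd≤ratio 114 2 648 289 3 4
λ₁-≤-3/4 7 _ = surd≤ratio 154 2 1029 400 3 4
λ₁-≤-3/4 8 _ = surd≤ratio 200 2 1536 529 3 4
λ₁-≤-3/4 (suc (suc (suc (suc (suc (suc (suc (suc (suc m))))))))) _ =
  through 45 88 (λ₁-large-≤-45/88 m) (ratio≤ratio 45 88 3 4)

-- In the top regime λ₂(k,ℓ) = (2k+ℓ)/(3ℓ) dominates λ₁(ℓ), for k ≥ 2: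
-- it is at least 1 = λ₁(2) for ℓ = 2 and at least 3/4 ≥ λ₁(ℓ) for ℓ ≥ 3.
λ₁⊑λ₂-top : ∀ j ℓ → 2 ≤ ℓ → 5 * ℓ ≤ 8 * (2 + j) → λ₁ ℓ ⊑ λ₂ (2 + j) ℓ
λ₁⊑λ₂-top j 0 ()
λ₁⊑λ₂-top j 1 (s≤s ())
λ₁⊑λ₂-top j 2 _ top = begin
    λ₁ 2
      ⊑⟨ ratio-≤ 2 2 (2 * (2 + j) + 2) (3 * 2) computed computed
           (≤-by-excess (4 * j)
              (solve 1 (λ j → con 2 :* (con 3 :* con 2) :+ con 4 :* j
                            := (con 2 :* (con 2 :+ j) :+ con 2) :* con 2) refl j)) ⟩
    nat (2 * (2 + j) + 2) ⊘ (3 * 2)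
      ⊑⟨ λ₂-top (2 + j) 2 top ⟩
    λ₂ (2 + j) 2
      ∎
  where open ⊑-Reasoning
λ₁⊑λ₂-top j ℓ@(suc (suc (suc _))) _ top = begin
    λ₁ ℓ                              ⊑⟨ λ₁-≤-3/4 ℓ (s≤s (s≤s (s≤s z≤n))) ⟩
    nat 3 ⊘ 4                         ⊑⟨ ratio-≤ 3 4 (2 * (2 + j) + ℓ) (3 * ℓ) computed (s≤s z≤n)
                                           (top-≥-3/4 (2 + j) ℓ top) ⟩
    nat (2 * (2 + j) + ℓ) ⊘ (3 * ℓ)   ⊑⟨ λ₂-top (2 + j) ℓ top ⟩
    λ₂ (2 + j) ℓ                      ∎
  where open ⊑-Reasoning

large-k-top : ∀ i ℓ → ℓ ≤ 8 → 5 * ℓ ≤ 8 * (5 + i)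
large-k-top i ℓ ℓ≤8 = begin
    5 * ℓ         ≤⟨ ℕP.*-monoʳ-≤ 5 ℓ≤8 ⟩
    40            ≤⟨ ℕP.m≤m+n 40 (8 * i) ⟩
    40 + 8 * i    ≡⟨ solve 1 (λ i → con 40 :+ con 8 :* i := con 8 :* (con 5 :+ i)) refl i ⟩
    8 * (5 + i)   ∎
  where open ℕP.≤-Reasoning

-- λ₁(ℓ) ≤ λ₂(k,ℓ) for k ≥ 2 and 2 ≤ ℓ ≤ 8 outside the exceptional pairs: the top
-- regime covers all but seven pairs, which are compared through a rational.
λ₁⊑λ₂-small : ∀ j ℓ → 2 ≤ ℓ → ℓ ≤ 8 → ¬ Exceptional (2 + j) ℓ → λ₁ ℓ ⊑ λ₂ (2 + j) ℓ
λ₁⊑λ₂-small (suc (suc (suc i))) ℓ 2≤ℓ ℓ≤8 _ = λ₁⊑λ₂-top (3 + i) ℓ 2≤ℓ (large-k-top i ℓ ℓ≤8)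
λ₁⊑λ₂-small j 0 () _ _
λ₁⊑λ₂-small j 1 (s≤s ()) _ _
λ₁⊑λ₂-small j 2 2≤ℓ _ _ = λ₁⊑λ₂-top j 2 2≤ℓ (≤-by-excess (6 + 8 * j)
  (solve 1 (λ j → con 5 :* con 2 :+ (con 6 :+ con 8 :* j) := con 8 :* (con 2 :+ j)) refl j))
λ₁⊑λ₂-small 0 3 _ _ _ = λ₁⊑λ₂-top 0 3 computed computed
λ₁⊑λ₂-small 0 4 _ _ _ =
  through 29 44 (surd≤ratio 52 2 192 121 29 44) (ratio≤surd 29 44 68 4 240 196)
λ₁⊑λ₂-small 0 5 _ _ ¬exc = ⊥-elim (¬exc exceptional)
λ₁⊑λ₂-small 0 6 _ _ ¬exc = ⊥-elim (¬exc exceptional)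
λ₁⊑λ₂-small 0 7 _ _ ¬exc = ⊥-elim (¬exc exceptional)
λ₁⊑λ₂-small 0 8 _ _ ¬exc = ⊥-elim (¬exc exceptional)
λ₁⊑λ₂-small 1 3 _ _ _ = λ₁⊑λ₂-top 1 3 computed computed
λ₁⊑λ₂-small 1 4 _ _ _ = λ₁⊑λ₂-top 1 4 computed computed
λ₁⊑λ₂-small 1 5 _ _ _ =
  through 2 3 (surd≤ratio 80 2 375 196 2 3) (ratio≤surd 2 3 92 4 480 245)
λ₁⊑λ₂-small 1 6 _ _ _ =
  through 3 5 (surd≤ratio 114 2 648 289 3 5) (ratio≤surd 3 5 102 4 540 294)
λ₁⊑λ₂-small 1 7 _ _ _ =
  through 3 5 (surd≤ratio 154 2 1029 400 3 5) (ratio≤surd 3 5 112 4 588 343)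
λ₁⊑λ₂-small 1 8 _ _ _ =
  through 5 9 (surd≤ratio 200 2 1536 529 5 9) (ratio≤surd 5 9 122 4 624 392)
λ₁⊑λ₂-small 2 3 _ _ _ = λ₁⊑λ₂-top 2 3 computed computed
λ₁⊑λ₂-small 2 4 _ _ _ = λ₁⊑λ₂-top 2 4 computed computed
λ₁⊑λ₂-small 2 5 _ _ _ = λ₁⊑λ₂-top 2 5 computed computed
λ₁⊑λ₂-small 2 6 _ _ _ = λ₁⊑λ₂-top 2 6 computed computed
λ₁⊑λ₂-small 2 7 _ _ _ =
  through 2 3 (surd≤ratio 154 2 1029 400 2 3) (ratio≤surd 2 3 126 4 882 343)
λ₁⊑λ₂-small 2 8 _ _ _ =
  through 3 5 (surd≤ratio 200 2 1536 529 3 5) (ratio≤surd 3 5 136 4 960 392)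
λ₁⊑λ₂-small j (suc (suc (suc (suc (suc (suc (suc (suc (suc _))))))))) _
  (s≤s (s≤s (s≤s (s≤s (s≤s (s≤s (s≤s (s≤s ())))))))) _

-- κ ≤ λ₂/k in the bottom regime: k/(ℓ(k−1)) ≤ (40k+10ℓ)/(44ℓk) amounts to the
-- margin 44k² ≤ (40k+10ℓ)(k−1); multiplied by ℓ it is the cleared inequality.
κ-cleared : ∀ j ℓ → 44 * (2 + j) * (2 + j) ≤ (40 * (2 + j) + 10 * ℓ) * suc j →
            (2 + j) * (44 * ℓ * (2 + j)) ≤ (40 * (2 + j) + 10 * ℓ) * (ℓ * suc j)
κ-cleared j ℓ margin = begin
    (2 + j) * (44 * ℓ * (2 + j))
      ≡⟨ solve 2 (λ j ℓ → (con 2 :+ j) :* (con 44 :* ℓ :* (con 2 :+ j))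
                        := ℓ :* (con 44 :* (con 2 :+ j) :* (con 2 :+ j))) refl j ℓ ⟩
    ℓ * (44 * (2 + j) * (2 + j))
      ≤⟨ ℕP.*-monoʳ-≤ ℓ margin ⟩
    ℓ * ((40 * (2 + j) + 10 * ℓ) * suc j)
      ≡⟨ solve 2 (λ j ℓ → ℓ :* ((con 40 :* (con 2 :+ j) :+ con 10 :* ℓ) :* (con 1 :+ j))
                        := (con 40 :* (con 2 :+ j) :+ con 10 :* ℓ) :* (ℓ :* (con 1 :+ j))) refl j ℓ ⟩
    (40 * (2 + j) + 10 * ℓ) * (ℓ * suc j)
      ∎
  where open ℕP.≤-Reasoning

κ⊑λ₂-bottom : ∀ j ℓ → 0 < ℓ → 96 * (2 + j) < 31 * ℓ →
              44 * (2 + j) * (2 + j) ≤ (40 * (2 + j) + 10 * ℓ) * suc j →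
              κ (2 + j) ℓ ⊑ λ₂ (2 + j) ℓ ⊘ (2 + j)
κ⊑λ₂-bottom j ℓ ℓ>0 bottom margin = begin
    κ k ℓ                   ⊑⟨ ratio-≤ k (ℓ * suc j) A (44 * ℓ * k) (*-positive ℓ>0 (s≤s z≤n))
                                 (*-positive (*-positive (computed {1} {44}) ℓ>0) (s≤s z≤n))
                                 (κ-cleared j ℓ margin) ⟩
    nat A ⊘ (44 * ℓ * k)    ⊑⟨ divide-lower (nat A) (44 * ℓ) k (≈⇒⊒ (λ₂-bottom k ℓ bottom)) ⟩
    λ₂ k ℓ ⊘ k              ∎
  where
  open ⊑-Reasoning
  k A : ℕ
  k = 2 + j
  A = 40 * k + 10 * ℓ

κ-margin-≥3 : ∀ i ℓ → 16 * (3 + i) < 5 * ℓ → 44 * (3 + i) * (3 + i) ≤ (40 * (3 + i) + 10 * ℓ) * (2 + i)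
κ-margin-≥3 i ℓ h = begin
    44 * (3 + i) * (3 + i)
      ≤⟨ ≤-by-excess (40 + 98 * i + 28 * i * i)
           (solve 1 (λ i → con 44 :* (con 3 :+ i) :* (con 3 :+ i)
                            :+ (con 40 :+ con 98 :* i :+ con 28 :* i :* i)
                         := con 40 :* (con 3 :+ i) :* (con 2 :+ i)
                            :+ con 2 :* (con 2 :+ i) :* (con 1 :+ con 16 :* (con 3 :+ i))) refl i) ⟩
    40 * (3 + i) * (2 + i) + 2 * (2 + i) * suc (16 * (3 + i))
      ≤⟨ ℕP.+-monoʳ-≤ (40 * (3 + i) * (2 + i)) (ℕP.*-monoʳ-≤ (2 * (2 + i)) h) ⟩
    40 * (3 + i) * (2 + i) + 2 * (2 + i) * (5 * ℓ)
      ≡⟨ solve 2 (λ i ℓ → con 40 :* (con 3 :+ i) :* (con 2 :+ i) :+ con 2 :* (con 2 :+ i) :* (con 5 :* ℓ)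
                        := (con 40 :* (con 3 :+ i) :+ con 10 :* ℓ) :* (con 2 :+ i)) refl i ℓ ⟩
    (40 * (3 + i) + 10 * ℓ) * (2 + i)
      ∎
  where open ℕP.≤-Reasoning

κ-margin-2 : ∀ m → 44 * 2 * 2 ≤ (40 * 2 + 10 * (10 + m)) * 1
κ-margin-2 m = ≤-by-excess (4 + 10 * m)
  (solve 1 (λ m → con 44 :* con 2 :* con 2 :+ (con 4 :+ con 10 :* m)
                := (con 40 :* con 2 :+ con 10 :* (con 10 :+ m)) :* con 1) refl m)

-- The margin for ℓ = 9 + m and 16k < 5ℓ; it fails only at the exceptional pair (2,9).
κ-margin : ∀ j m → 16 * (2 + j) < 5 * (9 + m) → ¬ Exceptional (2 + j) (9 + m) →
           44 * (2 + j) * (2 + j) ≤ (40 * (2 + j) + 10 * (9 + m)) * suc j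
κ-margin (suc i) m h _ = κ-margin-≥3 i (9 + m) h
κ-margin 0 0 _ ¬exc = ⊥-elim (¬exc exceptional)
κ-margin 0 (suc m) _ _ = κ-margin-2 m

MinBelowλ₂ : ℕ → ℕ → Set
MinBelowλ₂ k ℓ = min (λ₁ ℓ ⊘ k) (κ k ℓ) ⊑ λ₂ k ℓ ⊘ k

-- ℓ ≥ 9, k ≥ 2: through λ₁ ≤ 45/88 ≤ λ₂ when 5ℓ ≤ 16k, and through κ ≤ λ₂/k otherwise.
λ₁∧κ⊑λ₂-large : ∀ j m ℓ → 9 + m ≡ ℓ → ¬ Exceptional (2 + j) ℓ → MinBelowλ₂ (2 + j) ℓ
λ₁∧κ⊑λ₂-large j m .(9 + m) refl ¬exc = [ via-λ₁ , via-κ ]′ (ℕP.≤-<-connex (5 * ℓ) (16 * k))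
  where
  k ℓ : ℕ
  k = 2 + j
  ℓ = 9 + m
  via-λ₁ : 5 * ℓ ≤ 16 * k → MinBelowλ₂ k ℓ
  via-λ₁ h = min-⊑ˡ (⊘-mono k (through 45 88 (λ₁-large-≤-45/88 m) (45/88⊑λ₂ k ℓ (s≤s z≤n) h)))
  via-κ : 16 * k < 5 * ℓ → MinBelowλ₂ k ℓ
  via-κ h = min-⊑ʳ (κ⊑λ₂-bottom j ℓ (s≤s z≤n) (deep-bottom k ℓ h) (κ-margin j m h ¬exc))

λ₁∧κ⊑λ₂ : ∀ j ℓ → 2 ≤ ℓ → ¬ Exceptional (2 + j) ℓ → MinBelowλ₂ (2 + j) ℓ
λ₁∧κ⊑λ₂ j ℓ 2≤ℓ ¬exc = [ small , large ]′ (ℕP.≤-<-connex ℓ 8)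
  where
  small : ℓ ≤ 8 → MinBelowλ₂ (2 + j) ℓ
  small ℓ≤8 = min-⊑ˡ (⊘-mono (2 + j) (λ₁⊑λ₂-small j ℓ 2≤ℓ ℓ≤8 ¬exc))
  large : 8 < ℓ → MinBelowλ₂ (2 + j) ℓ
  large 9≤ℓ = let m , 9+m≡ℓ = ℕP.m≤n⇒∃[o]m+o≡n 9≤ℓ in λ₁∧κ⊑λ₂-large j m ℓ 9+m≡ℓ ¬exc

θ-exceptional-1 : ∀ ℓ → 0 < ℓ → 5 * ℓ ≤ 24 → λ₂ 1 ℓ ⊑ λ₁ ℓ → θ 1 ℓ ≈ λ₂ 1 ℓ ⊘ 1
θ-exceptional-1 ℓ ℓ>0 h λ₂⊑λ₁ =
  θ-collapse.to-b 1 ℓ (⊘-mono 1 λ₂⊑λ₁) (λ _ _ → tt) (divide-lower (nat 5) 12 1 (5/12⊑λ₂ 1 ℓ ℓ>0 h))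

-- Exceptional pairs with k = 2: moreover λ₂ ≤ 4/ℓ gives λ₂/2 ≤ κ = 2/ℓ.
θ-exceptional-2 : ∀ ℓ → 0 < ℓ → 5 * ℓ ≤ 48 → λ₂ 2 ℓ ⊑ λ₁ ℓ → λ₂ 2 ℓ ⊑ nat 4 ⊘ ℓ →
                  θ 2 ℓ ≈ λ₂ 2 ℓ ⊘ 2
θ-exceptional-2 ℓ ℓ>0 h λ₂⊑λ₁ λ₂≤4/ℓ =
  θ-collapse.to-b 2 ℓ (⊘-mono 2 λ₂⊑λ₁) λ₂/2⊑κ (divide-lower (nat 5) 12 2 (5/12⊑λ₂ 2 ℓ ℓ>0 h))
  where
  open ⊑-Reasoning
  λ₂/2⊑κ : λ₂ 2 ℓ ⊘ 2 ⊑ κ 2 ℓ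
  λ₂/2⊑κ = begin
    λ₂ 2 ℓ ⊘ 2        ⊑⟨ divide-upper (nat 4) ℓ 2 λ₂≤4/ℓ ⟩
    nat 4 ⊘ (ℓ * 2)   ⊑⟨ ratio-≤ 4 (ℓ * 2) 2 (ℓ * 1) (*-positive ℓ>0 computed) (*-positive ℓ>0 computed)
                           (ℕP.≤-reflexive
                              (solve 1 (λ ℓ → con 4 :* (ℓ :* con 1) := con 2 :* (ℓ :* con 2)) refl ℓ)) ⟩
    κ 2 ℓ             ∎

-- Part 1: the eight exceptional pairs, each with its closed comparisons
-- λ₂ ≤ r ≤ λ₁ (and λ₂ ≤ 4/ℓ for k = 2).
θ-exceptional : ∀ k ℓ → Exceptional k ℓ → θ k ℓ ≈ λ₂ k ℓ ⊘ k
θ-exceptional .1 .2 (here refl) = θ-exceptional-1 2 computed computed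
  (through 1 1 (surd≤ratio 34 4 60 98 1 1) (ratio≤ratio 1 1 2 2))
θ-exceptional .1 .3 (there (here refl)) = θ-exceptional-1 3 computed computed
  (through 2 3 (surd≤ratio 44 4 72 147 2 3) (ratio≤ratio 2 3 3 4))
θ-exceptional .1 .4 (there (there (here refl))) = θ-exceptional-1 4 computed computed
  (through 1 2 (ratio≤ratio 80 176 1 2) (ratio≤surd 1 2 52 2 192 121))
θ-exceptional .2 .5 (there (there (there (here refl)))) = θ-exceptional-2 5 computed computed
  (through 3 5 (surd≤ratio 78 4 270 245 3 5) (ratio≤surd 3 5 80 2 375 196))
  (surd≤ratio 78 4 270 245 4 5)
θ-exceptional .2 .6 (there (there (there (there (here refl))))) = θ-exceptional-2 6 computed computed
  (through 5 9 (surd≤ratio 88 4 288 294 5 9) (ratio≤surd 5 9 114 2 648 289))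
  (surd≤ratio 88 4 288 294 4 6)
θ-exceptional .2 .7 (there (there (there (there (there (here refl)))))) =
  θ-exceptional-2 7 computed computed
  (through 1 2 (ratio≤ratio 150 308 1 2) (ratio≤surd 1 2 154 2 1029 400))
  (ratio≤ratio 150 308 4 7)
θ-exceptional .2 .8 (there (there (there (there (there (there (here refl))))))) =
  θ-exceptional-2 8 computed computed
  (through 1 2 (ratio≤ratio 160 352 1 2) (ratio≤surd 1 2 200 2 1536 529))
  (ratio≤ratio 160 352 4 8)
θ-exceptional .2 .9 (there (there (there (there (there (there (there (here refl)))))))) =
  θ-exceptional-2 9 computed computed
  (through 1 2 (ratio≤ratio 170 396 1 2) (ratio≤ratio 1 2 45 88))
  (ratio≤ratio 170 396 4 9)

-- Part 2: for k = 1 and ℓ ≥ 5 the bottom regime gives λ₂(1,ℓ) = (40+10ℓ)/(44ℓ) ≤ 5/12,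
-- so that θ = min(f, K) = θ_B.
λ₂-1-≤-5/12 : ∀ m → λ₂ 1 (5 + m) ⊑ nat 5 ⊘ 12
λ₂-1-≤-5/12 m = begin
    λ₂ 1 ℓ                    ⊑⟨ ≈⇒⊑ (λ₂-bottom 1 ℓ (deep-bottom 1 ℓ 16<5ℓ)) ⟩
    nat A ⊘ (44 * ℓ)          ⊑⟨ ratio-≤ A (44 * ℓ) 5 12 (s≤s z≤n) computed cleared ⟩
    nat 5 ⊘ 12                ∎
  where
  open ⊑-Reasoning
  ℓ A : ℕ
  ℓ = 5 + m
  A = 40 * 1 + 10 * ℓ
  16<5ℓ : 16 * 1 < 5 * ℓ
  16<5ℓ = ≤-by-excess (8 + 5 * m)
    (solve 1 (λ m → con 1 :+ con 16 :* con 1 :+ (con 8 :+ con 5 :* m) := con 5 :* (con 5 :+ m)) refl m)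
  cleared : A * 12 ≤ 5 * (44 * ℓ)
  cleared = ≤-by-excess (20 + 100 * m)
    (solve 1 (λ m → (con 40 :* con 1 :+ con 10 :* (con 5 :+ m)) :* con 12 :+ (con 20 :+ con 100 :* m)
                  := con 5 :* (con 44 :* (con 5 :+ m))) refl m)

θ-at-1 : ∀ m ℓ → 5 + m ≡ ℓ → θ 1 ℓ ≈ θB 1 ℓ
θ-at-1 m .(5 + m) refl = θ-collapse.to-fK 1 (5 + m) (divide-upper (nat 5) 12 1 (λ₂-1-≤-5/12 m))

θ-part2 : ∀ k ℓ → k ≡ 1 → 5 ≤ ℓ → θ k ℓ ≈ θB k ℓ
θ-part2 .1 ℓ refl 5≤ℓ = let m , 5+m≡ℓ = ℕP.m≤n⇒∃[o]m+o≡n 5≤ℓ in θ-at-1 m ℓ 5+m≡ℓ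

θ-generic : ∀ j ℓ → 2 ≤ ℓ → ¬ Exceptional (2 + j) ℓ →
            θ (2 + j) ℓ ≈ min (λ₁ ℓ ⊘ (2 + j)) (κ (2 + j) ℓ)
θ-generic j ℓ 2≤ℓ ¬exc = θ-collapse.to-aK (2 + j) ℓ
  (divide-lower (nat 5) 12 (2 + j) (λ₁-≥-5/12 ℓ 2≤ℓ))
  (λ₁∧κ⊑λ₂ j ℓ 2≤ℓ ¬exc)

-- For k = 1 the pairs with ℓ ≤ 4 are exceptional and those with ℓ ≥ 5 belong to
-- part 2, so part 3 only concerns k ≥ 2.
θ-part3 : ∀ k ℓ → 1 ≤ k → 2 ≤ ℓ → ¬ Exceptional k ℓ → ¬ (k ≡ 1 × 5 ≤ ℓ) →
          θ k ℓ ≈ min (λ₁ ℓ ⊘ k) (κ k ℓ)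
θ-part3 0 _ () _ _ _
θ-part3 1 0 _ () _ _
θ-part3 1 1 _ (s≤s ()) _ _
θ-part3 1 2 _ _ ¬exc _ = ⊥-elim (¬exc exceptional)
θ-part3 1 3 _ _ ¬exc _ = ⊥-elim (¬exc exceptional)
θ-part3 1 4 _ _ ¬exc _ = ⊥-elim (¬exc exceptional)
θ-part3 1 (suc (suc (suc (suc (suc _))))) _ _ _ ¬part2 =
  ⊥-elim (¬part2 (refl , s≤s (s≤s (s≤s (s≤s (s≤s z≤n))))))
θ-part3 (suc (suc j)) ℓ _ 2≤ℓ ¬exc _ = θ-generic j ℓ 2≤ℓ ¬exc

lemma7p1 : (k ℓ : ℕ) → 1 ≤ k → 2 ≤ ℓ →
    (Exceptional k ℓ → θ k ℓ ≈ λ₂ k ℓ ⊘ k)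
    × (k ≡ 1 → 5 ≤ ℓ → θ k ℓ ≈ θB k ℓ)
    × (¬ Exceptional k ℓ → ¬ (k ≡ 1 × 5 ≤ ℓ) → θ k ℓ ≈ min (λ₁ ℓ ⊘ k) (κ k ℓ))
lemma7p1 k ℓ k≥1 ℓ≥2 = θ-exceptional k ℓ , θ-part2 k ℓ , θ-part3 k ℓ k≥1 ℓ≥2
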